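{- Let $T$ be a tree with vertices $v_1,\dots,v_n$ and let $B_T=(L_T+I_n)^{ -1}=[b_{ij}]$. Let $v_i$ be a vertex and consider a path $v_{i_0},v_{i_1},\dots,v_{i_k}$ in $T$ with $i_0=i$ and $v_{i_k}$ a pendant vertex (degree $1$). Then \[ b_{i,i_t}\ge 2\,b_{i,i_{t+1}}\qquad (0\le t\le k-1). \]
   Context: $L_T=D-A$ is the Laplacian matrix of $T$ ($A$ adjacency matrix, $D$ diagonal matrix of degrees), with row/column $i$ corresponding to vertex $v_i$; $L_T+I_n$ is positive definite, hence invertible. -}

module Defs where

open import Data.Nat using (ℕ; zero; suc; _≥_)
import Data.Nat as ℕ
open import Data.Fin using (Fin; zero; suc; inject₁; fromℕ; _≟_)
open import Data.Bool using (Bool; true; false; if_then_else_)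
open import Data.Rational using (ℚ; 0ℚ; 1ℚ; _+_; _*_; -_)
open import Data.Product using (Σ; _×_; ∃; ∃-syntax)
open import Relation.Nullary using (¬_; does)
open import Relation.Binary.PropositionalEquality using (_≡_)
open import Function.Definitions using (Injective)

record Graph (n : ℕ) : Set where
  field
    adj       : Fin n → Fin n → Bool
    symmetric : ∀ i j → adj i j ≡ adj j i
    irreflex  : ∀ i → adj i i ≡ false
open Graph public

∑ : ∀ {n} → (Fin n → ℚ) → ℚ
∑ {zero}  f = 0ℚ
∑ {suc n} f = f zero + ∑ (λ i → f (suc i))

countℕ : ∀ {n} → (Fin n → Bool) → ℕ
countℕ {zero}  f = 0
countℕ {suc n} f = (if f zero then 1 else 0) ℕ.+ countℕ (λ i → f (suc i))

degree : ∀ {n} → Graph n → Fin n → ℕ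
degree G i = countℕ (adj G i)

pendant : ∀ {n} → Graph n → Fin n → Set
pendant G i = degree G i ≡ 1

IsWalk : ∀ {n} → Graph n → (k : ℕ) → (Fin (suc k) → Fin n) → Set
IsWalk G k p = ∀ (t : Fin k) → adj G (p (inject₁ t)) (p (suc t)) ≡ true

IsPath : ∀ {n} → Graph n → (k : ℕ) → (Fin (suc k) → Fin n) → Set
IsPath G k p = IsWalk G k p × Injective _≡_ _≡_ p

Connected : ∀ {n} → Graph n → Set
Connected {n} G = ∀ (u v : Fin n) →
  ∃[ k ] Σ (Fin (suc k) → Fin n) λ p → IsWalk G k p × p zero ≡ u × p (fromℕ k) ≡ v

HasCycle : ∀ {n} → Graph n → Set
HasCycle {n} G = ∃[ k ] Σ (Fin (suc k) → Fin n) λ p →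
  k ≥ 2 × IsPath G k p × adj G (p (fromℕ k)) (p zero) ≡ true

IsTree : ∀ {n} → Graph n → Set
IsTree G = Connected G × ¬ HasCycle G

Matrix : ℕ → Set
Matrix n = Fin n → Fin n → ℚ

identity : ∀ {n} → Matrix n
identity i j = if does (i ≟ j) then 1ℚ else 0ℚ

_⊕_ : ∀ {n} → Matrix n → Matrix n → Matrix n
(M ⊕ N) i j = M i j + N i j

_⊗_ : ∀ {n} → Matrix n → Matrix n → Matrix n
(M ⊗ N) i j = ∑ (λ l → M i l * N l j)

ℕ→ℚ : ℕ → ℚ
ℕ→ℚ zero    = 0ℚ
ℕ→ℚ (suc m) = 1ℚ + ℕ→ℚ m

laplacian : ∀ {n} → Graph n → Matrix n
laplacian G i j =
  if does (i ≟ j) then ℕ→ℚ (degree G i)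
  else (if adj G i j then - 1ℚ else 0ℚ)

IsInverse : ∀ {n} → Matrix n → Matrix n → Set
IsInverse M B = (M ⊗ B) ≡ identity × (B ⊗ M) ≡ identity

{-# OPTIONS --safe #-}
-- Let y be row i of B. From B (L + I) = I, for every vertex u
--   y u + Σ_{l ~ u} (y u - y l) = δ i u.
-- At a minimum of y the sum is ≤ 0, so y ≥ 0. At u ≠ i with a neighbour w, the identity reads
--   0 = y u + (y u - y w) + Σ_{c ~ u, c ≠ w} (y u - y c),
-- and if 2 y c ≤ y u for all those c, every term of the last sum is ≥ y c ≥ 0, whence 2 y u ≤ y w.
-- In a forest, each neighbour c ≠ w of the last vertex u of a path from i extends that path,
-- so this local step proves the inequality for every edge of every path from i, by induction
-- on the number of vertices that a path can still gain (paths have fewer than n edges).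
module Submission where

open import Defs
open import Data.Nat using (ℕ; suc)
open import Data.Fin using (Fin; zero; suc; inject₁; fromℕ)
open import Data.Rational using (ℚ; _≤_; _*_; 1ℚ; _+_)
open import Relation.Binary.PropositionalEquality using (_≡_)

open import Data.Bool using (Bool; true; false; if_then_else_)
open import Data.Empty using (⊥-elim)
open import Data.Fin using (toℕ; inject≤; opposite; _≟_)
open import Data.Fin.Properties
  using (toℕ-injective; toℕ-inject≤; toℕ-inject₁; toℕ<n; inject≤-injective;
         opposite-involutive; suc-injective; 0≢1+n; injective⇒≤)
open import Data.List using (allFin)
import Data.List.Extrema
open import Data.List.Membership.Propositional.Properties using (∈-allFin)
open import Data.List.Relation.Unary.All using (lookup)
import Data.Nat as ℕ
open import Data.Nat.Properties using (+-suc; m≤m+n; ≤-trans; n≮n; n≤1+n)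
open import Data.Product using (∃-syntax; _,_; proj₁; proj₂)
open import Data.Rational using (0ℚ; -_; _-_)
open import Data.Rational.Properties
  using (≤-refl; +-mono-≤; +-monoˡ-≤; +-monoʳ-≤; +-identityˡ; +-identityʳ; +-inverseʳ;
         +-assoc; *-zeroʳ; ≤-decTotalOrder; nonNegative⁻¹; module ≤-Reasoning)
open import Data.Rational.Solver using (module +-*-Solver)
open import Data.Vec.Functional using (_∷_; last)
open import Function using (_∘_)
open import Function.Definitions using (Injective)
open import Relation.Binary.Bundles using (DecTotalOrder)
open import Relation.Binary.PropositionalEquality
  using (_≢_; refl; sym; trans; cong; cong₂; subst; subst₂; module ≡-Reasoning)
open import Relation.Nullary using (¬_; does; yes; no)
open import Relation.Nullary.Decidable using (dec-false)

open +-*-Solver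

p≤q⇒0≤q-p : ∀ {p q} → p ≤ q → 0ℚ ≤ q - p
p≤q⇒0≤q-p {p} {q} p≤q = begin
  0ℚ    ≡⟨ +-inverseʳ p ⟨
  p - p ≤⟨ +-monoˡ-≤ (- p) p≤q ⟩
  q - p ∎
  where open ≤-Reasoning

p≤q⇒p-q≤0 : ∀ {p q} → p ≤ q → p - q ≤ 0ℚ
p≤q⇒p-q≤0 {p} {q} p≤q = begin
  p - q ≤⟨ +-monoˡ-≤ (- q) p≤q ⟩
  q - q ≡⟨ +-inverseʳ q ⟩
  0ℚ    ∎
  where open ≤-Reasoning

0≤p∧2p≤q⇒p≤q : ∀ {p q} → 0ℚ ≤ p → (1ℚ + 1ℚ) * p ≤ q → p ≤ q
0≤p∧2p≤q⇒p≤q {p} {q} 0≤p 2p≤q = begin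
  p             ≡⟨ +-identityʳ p ⟨
  p + 0ℚ        ≤⟨ +-monoʳ-≤ p 0≤p ⟩
  p + p         ≡⟨ solve 1 (λ p → p :+ p := (con 1ℚ :+ con 1ℚ) :* p) refl p ⟩
  (1ℚ + 1ℚ) * p ≤⟨ 2p≤q ⟩
  q             ∎
  where open ≤-Reasoning

∃-minimiser : ∀ {n} (f : Fin n → ℚ) → Fin n → ∃[ m ] (∀ l → f m ≤ f l)
∃-minimiser {n} f l₀ =
  argmin f l₀ (allFin n) , λ l → lookup (f[argmin]≤f[xs] l₀ (allFin n)) (∈-allFin l)
  where open Data.List.Extrema (DecTotalOrder.totalOrder ≤-decTotalOrder)

∑-cong : ∀ {n} {f g : Fin n → ℚ} → (∀ l → f l ≡ g l) → ∑ f ≡ ∑ g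
∑-cong {ℕ.zero} f≗g = refl
∑-cong {suc n}  f≗g = cong₂ _+_ (f≗g zero) (∑-cong (f≗g ∘ suc))

∑-distrib-+ : ∀ {n} (f g : Fin n → ℚ) → ∑ (λ l → f l + g l) ≡ ∑ f + ∑ g
∑-distrib-+ {ℕ.zero} f g = refl
∑-distrib-+ {suc n}  f g = trans
  (cong ((f zero + g zero) +_) (∑-distrib-+ (f ∘ suc) (g ∘ suc)))
  (solve 4 (λ a b c d → (a :+ b) :+ (c :+ d) := (a :+ c) :+ (b :+ d)) refl
     (f zero) (g zero) (∑ (f ∘ suc)) (∑ (g ∘ suc)))

∑-0 : ∀ {n} → ∑ {n} (λ _ → 0ℚ) ≡ 0ℚ
∑-0 {ℕ.zero} = refl
∑-0 {suc n}  = cong (0ℚ +_) (∑-0 {n})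

∑-δ : ∀ {n} (u : Fin n) x → ∑ (λ l → if does (l ≟ u) then x else 0ℚ) ≡ x
∑-δ {suc n} zero    x = trans (cong (x +_) (∑-0 {n})) (+-identityʳ x)
∑-δ         (suc u) x = trans (+-identityˡ _) (∑-δ u x)

∑-if-const : ∀ {n} (b : Fin n → Bool) x →
  ∑ (λ l → if b l then x else 0ℚ) ≡ x * ℕ→ℚ (countℕ b)
∑-if-const {ℕ.zero} b x = sym (*-zeroʳ x)
∑-if-const {suc n}  b x with b zero
... | true  = trans (cong (x +_) (∑-if-const (b ∘ suc) x))
                (solve 2 (λ x c → x :+ x :* c := x :* (con 1ℚ :+ c)) refl
                   x (ℕ→ℚ (countℕ (b ∘ suc))))
... | false = trans (+-identityˡ _) (∑-if-const (b ∘ suc) x)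

∑≤0 : ∀ {n} (f : Fin n → ℚ) → (∀ l → f l ≤ 0ℚ) → ∑ f ≤ 0ℚ
∑≤0 {ℕ.zero} f f≤0 = ≤-refl
∑≤0 {suc n}  f f≤0 = +-mono-≤ (f≤0 zero) (∑≤0 (f ∘ suc) (f≤0 ∘ suc))

0≤∑ : ∀ {n} (f : Fin n → ℚ) → (∀ l → 0ℚ ≤ f l) → 0ℚ ≤ ∑ f
0≤∑ {ℕ.zero} f 0≤f = ≤-refl
0≤∑ {suc n}  f 0≤f = +-mono-≤ (0≤f zero) (0≤∑ (f ∘ suc) (0≤f ∘ suc))

term≤∑ : ∀ {n} (f : Fin n → ℚ) w → (∀ l → l ≢ w → 0ℚ ≤ f l) → f w ≤ ∑ f
term≤∑ f zero 0≤f = begin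
  f zero               ≡⟨ +-identityʳ (f zero) ⟨
  f zero + 0ℚ          ≤⟨ +-monoʳ-≤ (f zero) (0≤∑ (f ∘ suc) (λ l → 0≤f (suc l) (0≢1+n ∘ sym))) ⟩
  f zero + ∑ (f ∘ suc) ∎
  where open ≤-Reasoning
term≤∑ f (suc w) 0≤f = begin
  f (suc w)            ≡⟨ +-identityˡ (f (suc w)) ⟨
  0ℚ + f (suc w)       ≤⟨ +-mono-≤ (0≤f zero 0≢1+n) (term≤∑ (f ∘ suc) w 0≤f∘suc) ⟩
  f zero + ∑ (f ∘ suc) ∎
  where
  open ≤-Reasoning
  0≤f∘suc : ∀ l → l ≢ w → 0ℚ ≤ f (suc l)
  0≤f∘suc l l≢w = 0≤f (suc l) (l≢w ∘ suc-injective)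

0≤identity : ∀ {n} (i u : Fin n) → 0ℚ ≤ identity i u
0≤identity i u with does (i ≟ u)
... | true  = nonNegative⁻¹ 1ℚ
... | false = ≤-refl

identity-off : ∀ {n} {i u : Fin n} → u ≢ i → identity i u ≡ 0ℚ
identity-off {i = i} {u} u≢i rewrite dec-false (i ≟ u) (u≢i ∘ sym) = refl

adj⇒≢ : ∀ {n} (T : Graph n) {u v} → adj T u v ≡ true → u ≢ v
adj⇒≢ T {u} uv refl with trans (sym uv) (irreflex T u)
... | ()

module _ {n} (T : Graph n) (y : Fin n → ℚ) where

  edgeDiff : Fin n → Fin n → ℚ
  edgeDiff u l = if adj T u l then y u - y l else 0ℚ

  ∑-laplacian+identity : ∀ u →
    ∑ (λ l → y l * (laplacian T ⊕ identity) l u) ≡ y u + ∑ (edgeDiff u)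
  ∑-laplacian+identity u = begin
    ∑ (λ l → y l * (laplacian T ⊕ identity) l u)    ≡⟨ ∑-cong split ⟩
    ∑ (λ l → diagonal l + offDiagonal l)            ≡⟨ ∑-distrib-+ diagonal offDiagonal ⟩
    ∑ diagonal + ∑ offDiagonal                      ≡⟨ cong (_+ ∑ offDiagonal) (∑-δ u _) ⟩
    (y u + y u * ℕ→ℚ (degree T u)) + ∑ offDiagonal  ≡⟨ cong (λ z → (y u + z) + ∑ offDiagonal)
                                                         (∑-if-const (adj T u) (y u)) ⟨
    (y u + ∑ towardsU) + ∑ offDiagonal              ≡⟨ +-assoc (y u) _ _ ⟩
    y u + (∑ towardsU + ∑ offDiagonal)              ≡⟨ cong (y u +_)
                                                         (∑-distrib-+ towardsU offDiagonal) ⟨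
    y u + ∑ (λ l → towardsU l + offDiagonal l)      ≡⟨ cong (y u +_) (∑-cong merge) ⟩
    y u + ∑ (edgeDiff u)                            ∎
    where
    open ≡-Reasoning
    diagonal offDiagonal towardsU : Fin n → ℚ
    diagonal    l = if does (l ≟ u) then y u + y u * ℕ→ℚ (degree T u) else 0ℚ
    offDiagonal l = if adj T u l then - y l else 0ℚ
    towardsU    l = if adj T u l then y u else 0ℚ

    split : ∀ l → y l * (laplacian T ⊕ identity) l u ≡ diagonal l + offDiagonal l
    split l with l ≟ u
    ... | yes refl rewrite irreflex T l =
      solve 2 (λ y d → y :* (d :+ con 1ℚ) := (y :+ y :* d) :+ con 0ℚ) refl
        (y l) (ℕ→ℚ (degree T l))
    ... | no _ rewrite symmetric T l u with adj T u l
    ...   | true  = solve 1 (λ y → y :* (:- con 1ℚ :+ con 0ℚ) := con 0ℚ :+ :- y) refl (y l)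
    ...   | false = solve 1 (λ y → y :* (con 0ℚ :+ con 0ℚ) := con 0ℚ :+ con 0ℚ) refl (y l)

    merge : ∀ l → towardsU l + offDiagonal l ≡ edgeDiff u l
    merge l with adj T u l
    ... | true  = refl
    ... | false = refl

  edgeDiff≤0 : ∀ {u l} → (adj T u l ≡ true → y u ≤ y l) → edgeDiff u l ≤ 0ℚ
  edgeDiff≤0 {u} {l} y[u]≤y[l] with adj T u l
  ... | true  = p≤q⇒p-q≤0 (y[u]≤y[l] refl)
  ... | false = ≤-refl

  0≤edgeDiff : ∀ {u l} → (adj T u l ≡ true → y l ≤ y u) → 0ℚ ≤ edgeDiff u l
  0≤edgeDiff {u} {l} y[l]≤y[u] with adj T u l
  ... | true  = p≤q⇒0≤q-p (y[l]≤y[u] refl)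
  ... | false = ≤-refl

  minimum-principle : (∀ u → 0ℚ ≤ y u + ∑ (edgeDiff u)) → ∀ u → 0ℚ ≤ y u
  minimum-principle 0≤[L+I]y u with ∃-minimiser y u
  ... | m , y[m]≤ = begin
    0ℚ                   ≤⟨ 0≤[L+I]y m ⟩
    y m + ∑ (edgeDiff m) ≤⟨ +-monoʳ-≤ (y m) (∑≤0 (edgeDiff m) (λ l → edgeDiff≤0 (λ _ → y[m]≤ l))) ⟩
    y m + 0ℚ             ≡⟨ +-identityʳ (y m) ⟩
    y m                  ≤⟨ y[m]≤ u ⟩
    y u                  ∎
    where open ≤-Reasoning

  halving-step : ∀ {u w} → (∀ l → 0ℚ ≤ y l) → y u + ∑ (edgeDiff u) ≡ 0ℚ → adj T u w ≡ true →
    (∀ c → adj T u c ≡ true → c ≢ w → (1ℚ + 1ℚ) * y c ≤ y u) →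
    (1ℚ + 1ℚ) * y u ≤ y w
  halving-step {u} {w} 0≤y [L+I]y≡0 uw halved = begin
    (1ℚ + 1ℚ) * y u              ≡⟨ solve 2 (λ a b → (con 1ℚ :+ con 1ℚ) :* a := (a :+ (a :- b)) :+ b)
                                      refl (y u) (y w) ⟩
    (y u + (y u - y w)) + y w    ≡⟨ cong (λ z → (y u + z) + y w) edgeDiff-uw ⟨
    (y u + edgeDiff u w) + y w   ≤⟨ +-monoˡ-≤ (y w) (+-monoʳ-≤ (y u) (term≤∑ (edgeDiff u) w others)) ⟩
    (y u + ∑ (edgeDiff u)) + y w ≡⟨ cong (_+ y w) [L+I]y≡0 ⟩
    0ℚ + y w                     ≡⟨ +-identityˡ (y w) ⟩
    y w                          ∎
    where
    open ≤-Reasoning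
    edgeDiff-uw : edgeDiff u w ≡ y u - y w
    edgeDiff-uw rewrite uw = refl
    others : ∀ l → l ≢ w → 0ℚ ≤ edgeDiff u l
    others l l≢w = 0≤edgeDiff (λ ul → 0≤p∧2p≤q⇒p≤q (0≤y l) (halved l ul l≢w))

opposite-inject₁ : ∀ {k} (t : Fin k) → opposite (inject₁ t) ≡ suc (opposite t)
opposite-inject₁ {suc k} zero    = refl
opposite-inject₁ {suc k} (suc t) = cong inject₁ (opposite-inject₁ t)

inject≤-inject₁ : ∀ {j m} (t : Fin j) .(sj≤sm : suc j ℕ.≤ suc m) .(j≤m : j ℕ.≤ m) →
  inject≤ (inject₁ t) sj≤sm ≡ inject₁ (inject≤ t j≤m)
inject≤-inject₁ t sj≤sm j≤m = toℕ-injective (begin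
  toℕ (inject≤ (inject₁ t) sj≤sm) ≡⟨ toℕ-inject≤ (inject₁ t) sj≤sm ⟩
  toℕ (inject₁ t)                 ≡⟨ toℕ-inject₁ t ⟩
  toℕ t                           ≡⟨ toℕ-inject≤ t j≤m ⟨
  toℕ (inject≤ t j≤m)             ≡⟨ toℕ-inject₁ (inject≤ t j≤m) ⟨
  toℕ (inject₁ (inject≤ t j≤m))   ∎)
  where open ≡-Reasoning

inject≤-fromℕ-toℕ : ∀ {m} (j : Fin m) .(sj≤m : suc (toℕ j) ℕ.≤ m) →
  inject≤ (fromℕ (toℕ j)) sj≤m ≡ j
inject≤-fromℕ-toℕ zero    _ = refl
inject≤-fromℕ-toℕ (suc j) _ = cong suc (inject≤-fromℕ-toℕ j _)

module _ {n} (T : Graph n) where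

  IsPath-tail : ∀ {m} {r : Fin (suc (suc m)) → Fin n} →
    IsPath T (suc m) r → IsPath T m (r ∘ suc)
  IsPath-tail (walk , inj) = walk ∘ suc , suc-injective ∘ inj

  IsPath-reverse : ∀ {k} {p : Fin (suc k) → Fin n} → IsPath T k p → IsPath T k (p ∘ opposite)
  IsPath-reverse {k} {p} (walk , inj) = walk′ , inj′
    where
    walk′ : IsWalk T k (p ∘ opposite)
    walk′ t = subst (λ v → adj T (p v) (p (opposite (suc t))) ≡ true) (sym (opposite-inject₁ t))
                (trans (symmetric T _ _) (walk (opposite t)))
    inj′ : Injective _≡_ _≡_ (p ∘ opposite)
    inj′ {s} {s′} e = trans (sym (opposite-involutive s))
                        (trans (cong opposite (inj e)) (opposite-involutive s′))

  IsPath-inject≤ : ∀ {j m} {r : Fin (suc m) → Fin n} → IsPath T m r →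
    .(sj≤sm : suc j ℕ.≤ suc m) → IsPath T j (λ s → r (inject≤ s sj≤sm))
  IsPath-inject≤ {j} {r = r} (walk , inj) sj≤sm = walk′ , inj′
    where
    walk′ : IsWalk T j (λ s → r (inject≤ s sj≤sm))
    walk′ t = subst (λ v → adj T (r v) (r (suc (inject≤ t _))) ≡ true)
                (sym (inject≤-inject₁ t sj≤sm (ℕ.s≤s⁻¹ sj≤sm))) (walk (inject≤ t _))
    inj′ : Injective _≡_ _≡_ (λ s → r (inject≤ s sj≤sm))
    inj′ e = inject≤-injective _ _ _ _ (inj e)

  module _ (acyclic : ¬ HasCycle T) {m c} {r : Fin (suc (suc m)) → Fin n}
    (path : IsPath T (suc m) r) (uc : adj T (r zero) c ≡ true) (c≢w : c ≢ r (suc zero)) where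

    neighbour∉path : ∀ j → c ≢ r j
    neighbour∉path zero            c≡u = adj⇒≢ T uc (sym c≡u)
    neighbour∉path (suc zero)      c≡w = c≢w c≡w
    neighbour∉path j@(suc (suc _)) c≡r[j] =
      acyclic (toℕ j , _ , ℕ.s≤s (ℕ.s≤s ℕ.z≤n) , IsPath-inject≤ path (toℕ<n j) , closing)
      where
      closing : adj T (r (inject≤ (fromℕ (toℕ j)) (toℕ<n j))) (r zero) ≡ true
      closing rewrite inject≤-fromℕ-toℕ j (toℕ<n j) =
        subst (λ v → adj T v (r zero) ≡ true) c≡r[j] (trans (symmetric T _ _) uc)

    IsPath-∷ : IsPath T (suc (suc m)) (c ∷ r)
    IsPath-∷ = walk′ , inj′
      where
      walk′ : IsWalk T (suc (suc m)) (c ∷ r)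
      walk′ zero    = trans (symmetric T _ _) uc
      walk′ (suc t) = proj₁ path t
      inj′ : Injective _≡_ _≡_ (c ∷ r)
      inj′ {zero}  {zero}  _ = refl
      inj′ {zero}  {suc l} e = ⊥-elim (neighbour∉path l e)
      inj′ {suc j} {zero}  e = ⊥-elim (neighbour∉path j (sym e))
      inj′ {suc j} {suc l} e = cong suc (proj₂ path e)

-- Paths r are traversed backwards here: r zero is the far end and last r is the root,
-- so that extending the far end is just c ∷ r.
module _ {n} (T : Graph n) (acyclic : ¬ HasCycle T) (i : Fin n) (R : Fin n → Fin n → Set)
  (R-step : ∀ w u → adj T w u ≡ true → u ≢ i →
            (∀ c → adj T u c ≡ true → c ≢ w → R u c) → R w u) where

  R-first-edge : ∀ fuel {m} (r : Fin (suc (suc m)) → Fin n) → n ℕ.≤ fuel ℕ.+ m →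
    IsPath T (suc m) r → last r ≡ i → R (r (suc zero)) (r zero)
  R-first-edge ℕ.zero {m} r n≤m (_ , inj) _ =
    ⊥-elim (n≮n m (≤-trans (n≤1+n (suc m)) (≤-trans (injective⇒≤ inj) n≤m)))
  R-first-edge (suc fuel) {m} r n≤fuel+m path@(walk , inj) last≡i =
    R-step (r (suc zero)) (r zero) (trans (symmetric T _ _) (walk zero))
      (λ r₀≡i → 0≢1+n (inj (trans r₀≡i (sym last≡i)))) beyond
    where
    beyond : ∀ c → adj T (r zero) c ≡ true → c ≢ r (suc zero) → R (r zero) c
    beyond c uc c≢w =
      R-first-edge fuel (c ∷ r) (subst (n ℕ.≤_) (sym (+-suc fuel m)) n≤fuel+m)
        (IsPath-∷ T acyclic path uc c≢w) last≡i

  R-along-reversed-path : ∀ {m} (r : Fin (suc m) → Fin n) → IsPath T m r → last r ≡ i →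
    ∀ s → R (r (suc s)) (r (inject₁ s))
  R-along-reversed-path {suc m} r path last≡i zero    = R-first-edge n r (m≤m+n n m) path last≡i
  R-along-reversed-path {suc m} r path last≡i (suc s) =
    R-along-reversed-path (r ∘ suc) (IsPath-tail T path) last≡i s

  R-along-path : ∀ {k} (p : Fin (suc k) → Fin n) → IsPath T k p → p zero ≡ i →
    ∀ t → R (p (inject₁ t)) (p (suc t))
  R-along-path p path p₀≡i t = subst₂ R
    (cong (p ∘ inject₁) (opposite-involutive t))
    (cong p (trans (opposite-inject₁ (opposite t)) (cong suc (opposite-involutive t))))
    (R-along-reversed-path (p ∘ opposite) (IsPath-reverse T path)
      (trans (cong p (opposite-involutive zero)) p₀≡i) (opposite t))

theorem3p3 : ∀ {n} (T : Graph n) → IsTree T →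
    ∀ (B : Matrix n) → IsInverse (laplacian T ⊕ identity) B →
    ∀ (i : Fin n) (k : ℕ) (p : Fin (suc k) → Fin n) →
      IsPath T k p → p zero ≡ i → pendant T (p (fromℕ k)) →
      ∀ (t : Fin k) → (1ℚ + 1ℚ) * B i (p (suc t)) ≤ B i (p (inject₁ t))
theorem3p3 {n} T (_ , acyclic) B (_ , B[L+I]≡I) i k p path p₀≡i _ =
  R-along-path T acyclic i (λ w u → (1ℚ + 1ℚ) * y u ≤ y w) halving p path p₀≡i
  where
  y : Fin n → ℚ
  y = B i
  [L+I]y≡δ : ∀ u → y u + ∑ (edgeDiff T y u) ≡ identity i u
  [L+I]y≡δ u = trans (sym (∑-laplacian+identity T y u)) (cong (λ M → M i u) B[L+I]≡I)
  0≤y : ∀ l → 0ℚ ≤ y l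
  0≤y = minimum-principle T y (λ u → subst (0ℚ ≤_) (sym ([L+I]y≡δ u)) (0≤identity i u))
  halving : ∀ w u → adj T w u ≡ true → u ≢ i →
    (∀ c → adj T u c ≡ true → c ≢ w → (1ℚ + 1ℚ) * y c ≤ y u) → (1ℚ + 1ℚ) * y u ≤ y w
  halving w u wu u≢i = halving-step T y 0≤y (trans ([L+I]y≡δ u) (identity-off u≢i))
                         (trans (symmetric T u w) wu)
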